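{- Let $(L;\wedge,\vee,^{\Delta},^{\nabla},0,1)$ be a weakly dicomplemented lattice, let $F$ be an S-filter of $L$, let $G$ be a filter of $\overline{S}(L)$, and put $E=F\cap\overline{S}(L)$ and $F_G=\{x\in L\mid x^{\Delta\Delta}\in G\}$. Then: (i) $F_G$ is an S-filter of $L$ and $F_G\cap\overline{S}(L)=G$; (ii) $E$ is a filter of $\overline{S}(L)$ and $F_E=F$; (iii) $F$ is a primary filter of $L$ if and only if $E$ is a primary filter of $\overline{S}(L)$.
   Context: A weakly dicomplemented lattice (WDL) is an algebra $(L;\wedge,\vee,^{\Delta},^{\nabla},0,1)$ such that $(L;\wedge,\vee,0,1)$ is a bounded lattice and, for all $x,y\in L$: $x^{\Delta\Delta}\le x$; $x\le y\Rightarrow y^{\Delta}\le x^{\Delta}$; $(x\wedge y)\vee(x\wedge y^{\Delta})=x$; $x^{\nabla\nabla}\ge x$; $x\le y\Rightarrow y^{\nabla}\le x^{\nabla}$; $(x\vee y)\wedge(x\vee y^{\nabla})=x$. A filter of $L$ is a nonempty upward closed subset closed under $\wedge$. $\overline{S}(L)=\{x\in L\mid x^{\Delta\Delta}=x\}$, $x\,\overline{\sqcap}\,y=(x^{\Delta}\vee y^{\Delta})^{\Delta}$; a filter of $\overline{S}(L)$ is a nonempty subset of $\overline{S}(L)$ upward closed within $\overline{S}(L)$ and closed under $\overline{\sqcap}$. An S-filter of $L$ is a filter $F$ of $L$ such that $x,y\in F$ implies $x\,\overline{\sqcap}\,y\in F$. A filter $F$ of $L$ is primary if for every $x\in L$,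 $x\in F$ or $x^{\Delta}\in F$; a filter $G$ of $\overline{S}(L)$ is primary if for every $x\in\overline{S}(L)$, $x\in G$ or $x^{\Delta}\in G$. -}

module Defs where

open import Level using (Level; _⊔_) renaming (suc to lsuc)
open import Data.Product using (Σ; _×_; ∃; _,_)
open import Data.Sum using (_⊎_)
open import Relation.Unary using (Pred; _∈_; _∩_; _≐_)
open import Relation.Binary.PropositionalEquality using (_≡_)
open import Algebra.Lattice.Structures using (IsLattice)

record WDL (c : Level) : Set (lsuc c) where
  infixr 7 _∧_
  infixr 6 _∨_
  infix 4 _≤_
  field
    Carrier   : Set c
    _∧_ _∨_   : Carrier → Carrier → Carrier
    _ᐞ _ᐁ     : Carrier → Carrier   -- x ᐞ is x^Δ, x ᐁ is x^∇
    0# 1#     : Carrier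
    isLattice : IsLattice _≡_ _∨_ _∧_

  _≤_ : Carrier → Carrier → Set c
  x ≤ y = x ∧ y ≡ x

  field
    0-least    : ∀ x → 0# ≤ x
    1-greatest : ∀ x → x ≤ 1#
    ΔΔ-≤       : ∀ x → (x ᐞ) ᐞ ≤ x
    Δ-antitone : ∀ {x y} → x ≤ y → y ᐞ ≤ x ᐞ
    Δ-split    : ∀ x y → (x ∧ y) ∨ (x ∧ y ᐞ) ≡ x
    ∇∇-≥       : ∀ x → x ≤ (x ᐁ) ᐁ
    ∇-antitone : ∀ {x y} → x ≤ y → y ᐁ ≤ x ᐁ
    ∇-split    : ∀ x y → (x ∨ y) ∧ (x ∨ y ᐁ) ≡ x

module _ {c : Level} (L : WDL c) where
  open WDL L

  S̄ : Pred Carrier c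
  S̄ x = (x ᐞ) ᐞ ≡ x

  _⊓̄_ : Carrier → Carrier → Carrier
  x ⊓̄ y = ((x ᐞ) ∨ (y ᐞ)) ᐞ

  record IsFilter {ℓ : Level} (F : Pred Carrier ℓ) : Set (c ⊔ ℓ) where
    field
      nonempty : ∃ λ x → x ∈ F
      upward   : ∀ {x y} → x ∈ F → x ≤ y → y ∈ F
      ∧-closed : ∀ {x y} → x ∈ F → y ∈ F → (x ∧ y) ∈ F

  record IsS̄Filter {ℓ : Level} (G : Pred Carrier ℓ) : Set (c ⊔ ℓ) where
    field
      ⊆S̄       : ∀ {x} → x ∈ G → x ∈ S̄
      nonempty : ∃ λ x → x ∈ G
      upward   : ∀ {x y} → x ∈ G → y ∈ S̄ → x ≤ y → y ∈ G
      ⊓̄-closed : ∀ {x y} → x ∈ G → y ∈ G → (x ⊓̄ y) ∈ G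

  record IsSFilter {ℓ : Level} (F : Pred Carrier ℓ) : Set (c ⊔ ℓ) where
    field
      isFilter : IsFilter F
      ⊓̄-closed : ∀ {x y} → x ∈ F → y ∈ F → (x ⊓̄ y) ∈ F

  IsPrimaryFilter : {ℓ : Level} → Pred Carrier ℓ → Set (c ⊔ ℓ)
  IsPrimaryFilter F = IsFilter F × (∀ x → x ∈ F ⊎ (x ᐞ) ∈ F)

  IsPrimaryS̄Filter : {ℓ : Level} → Pred Carrier ℓ → Set (c ⊔ ℓ)
  IsPrimaryS̄Filter G = IsS̄Filter G × (∀ x → x ∈ S̄ → x ∈ G ⊎ (x ᐞ) ∈ G)

  F[_] : {ℓ : Level} → Pred Carrier ℓ → Pred Carrier ℓ
  F[ G ] x = ((x ᐞ) ᐞ) ∈ G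

{-# OPTIONS --safe #-}
module Submission where

-- The map x ↦ x^ΔΔ is an interior operator on L whose fixed points form S̄(L), and
-- x ⊓̄ y = (x ∧ y)^ΔΔ. Hence the S-filters of L are exactly the filters closed under ΔΔ,
-- and such a filter is recovered from its trace on S̄(L) because x and x^ΔΔ belong to it
-- together. Primality transfers by testing x^ΔΔ, using x^ΔΔΔ = x^Δ.

open import Defs
open import Level using (Level; _⊔_)
open import Data.Product using (_×_; _,_; proj₁)
import Data.Sum as Sum
open import Function.Bundles using (_⇔_; mk⇔)
open import Relation.Unary using (Pred; _∈_; _⊆_; _∩_; _≐_)
open import Relation.Binary.PropositionalEquality using (_≡_; sym; trans; cong; cong₂; subst)
open import Algebra.Lattice.Bundles using (Lattice)
import Algebra.Lattice.Properties.Lattice as LatticeProperties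
import Relation.Binary.Lattice as OrderTheoretic

module WDLProperties {c : Level} (L : WDL c) where
  open WDL L

  private
    lattice : Lattice c c
    lattice = record { isLattice = isLattice }

    open LatticeProperties lattice using (∧-idem; ∨-∧-orderTheoreticLattice)

    -- The order x ∧ y ≡ x of WDL is the library's order x ≈ x ∧ y read backwards.
    module O = OrderTheoretic.Lattice ∨-∧-orderTheoreticLattice

  ≤-trans : ∀ {x y z} → x ≤ y → y ≤ z → x ≤ z
  ≤-trans x≤y y≤z = sym (O.trans (sym x≤y) (sym y≤z))

  ≤-antisym : ∀ {x y} → x ≤ y → y ≤ x → x ≡ y
  ≤-antisym x≤y y≤x = O.antisym (sym x≤y) (sym y≤x)

  x∧y≤x : ∀ x y → x ∧ y ≤ x
  x∧y≤x x y = sym (O.x∧y≤x x y)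

  x∧y≤y : ∀ x y → x ∧ y ≤ y
  x∧y≤y x y = sym (O.x∧y≤y x y)

  ∧-greatest : ∀ {x y z} → x ≤ y → x ≤ z → x ≤ y ∧ z
  ∧-greatest x≤y x≤z = sym (O.∧-greatest (sym x≤y) (sym x≤z))

  x≤x∨y : ∀ x y → x ≤ x ∨ y
  x≤x∨y x y = sym (O.x≤x∨y x y)

  y≤x∨y : ∀ x y → y ≤ x ∨ y
  y≤x∨y x y = sym (O.y≤x∨y x y)

  ∨-least : ∀ {x y z} → x ≤ z → y ≤ z → x ∨ y ≤ z
  ∨-least x≤z y≤z = sym (O.∨-least (sym x≤z) (sym y≤z))

  ᐞᐞ-monotone : ∀ {x y} → x ≤ y → x ᐞ ᐞ ≤ y ᐞ ᐞ
  ᐞᐞ-monotone x≤y = Δ-antitone (Δ-antitone x≤y)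

  ᐞᐞᐞ≡ᐞ : ∀ x → x ᐞ ᐞ ᐞ ≡ x ᐞ
  ᐞᐞᐞ≡ᐞ x = ≤-antisym (ΔΔ-≤ (x ᐞ)) (Δ-antitone (ΔΔ-≤ x))

  ᐞ∈S̄ : ∀ x → x ᐞ ∈ S̄ L
  ᐞ∈S̄ = ᐞᐞᐞ≡ᐞ

  ᐞᐞ∈S̄ : ∀ x → x ᐞ ᐞ ∈ S̄ L
  ᐞᐞ∈S̄ x = ᐞ∈S̄ (x ᐞ)

  ⊓̄-ᐞᐞ : ∀ x y → _⊓̄_ L (x ᐞ ᐞ) (y ᐞ ᐞ) ≡ _⊓̄_ L x y
  ⊓̄-ᐞᐞ x y = cong₂ (λ a b → (a ∨ b) ᐞ) (ᐞᐞᐞ≡ᐞ x) (ᐞᐞᐞ≡ᐞ y)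

  ⊓̄≡ᐞᐞ∧ : ∀ x y → _⊓̄_ L x y ≡ (x ∧ y) ᐞ ᐞ
  ⊓̄≡ᐞᐞ∧ x y = ≤-antisym ⊓̄≤ᐞᐞ∧ ᐞᐞ∧≤⊓̄
    where
    ⊓̄≤∧ : _⊓̄_ L x y ≤ x ∧ y
    ⊓̄≤∧ = ∧-greatest (≤-trans (Δ-antitone (x≤x∨y (x ᐞ) (y ᐞ))) (ΔΔ-≤ x))
                     (≤-trans (Δ-antitone (y≤x∨y (x ᐞ) (y ᐞ))) (ΔΔ-≤ y))

    ⊓̄≤ᐞᐞ∧ : _⊓̄_ L x y ≤ (x ∧ y) ᐞ ᐞ
    ⊓̄≤ᐞᐞ∧ = subst (_≤ (x ∧ y) ᐞ ᐞ) (ᐞ∈S̄ (x ᐞ ∨ y ᐞ)) (ᐞᐞ-monotone ⊓̄≤∧)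

    ᐞᐞ∧≤⊓̄ : (x ∧ y) ᐞ ᐞ ≤ _⊓̄_ L x y
    ᐞᐞ∧≤⊓̄ = Δ-antitone
      (∨-least (Δ-antitone (x∧y≤x x y)) (Δ-antitone (x∧y≤y x y)))

  ⊓̄-idem : ∀ x → _⊓̄_ L x x ≡ x ᐞ ᐞ
  ⊓̄-idem x = trans (⊓̄≡ᐞᐞ∧ x x) (cong (λ a → a ᐞ ᐞ) (∧-idem x))

module Filters {c : Level} (L : WDL c) where
  open WDL L
  open WDLProperties L

  private
    variable
      ℓ : Level
      F G : Pred Carrier ℓ

  ᐞᐞ-Closed : Pred Carrier ℓ → Set (c ⊔ ℓ)
  ᐞᐞ-Closed F = ∀ {x} → x ∈ F → x ᐞ ᐞ ∈ F

  isSFilter⇒ᐞᐞ-closed : IsSFilter L F → ᐞᐞ-Closed F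
  isSFilter⇒ᐞᐞ-closed {F = F} F-sf {x} x∈F =
    subst F (⊓̄-idem x) (IsSFilter.⊓̄-closed F-sf x∈F x∈F)

  ᐞᐞ-closed⇒isSFilter : IsFilter L F → ᐞᐞ-Closed F → IsSFilter L F
  ᐞᐞ-closed⇒isSFilter {F = F} F-f closed = record
    { isFilter = F-f
    ; ⊓̄-closed = λ {x} {y} x∈F y∈F →
        subst F (sym (⊓̄≡ᐞᐞ∧ x y)) (closed (IsFilter.∧-closed F-f x∈F y∈F))
    }

  F[G]-isSFilter : IsS̄Filter L G → IsSFilter L (F[_] L G)
  F[G]-isSFilter {G = G} G-f =
    ᐞᐞ-closed⇒isSFilter F[G]-isFilter (λ {x} → subst G (sym (ᐞᐞ∈S̄ x)))
    where
    open IsS̄Filter G-f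

    F[G]-isFilter : IsFilter L (F[_] L G)
    F[G]-isFilter = record
      { nonempty = let g , g∈G = nonempty in g , subst G (sym (⊆S̄ g∈G)) g∈G
      ; upward   = λ {x} {y} x∈F[G] x≤y → upward x∈F[G] (ᐞᐞ∈S̄ y) (ᐞᐞ-monotone x≤y)
      ; ∧-closed = λ {x} {y} x∈F[G] y∈F[G] →
          subst G (trans (⊓̄-ᐞᐞ x y) (⊓̄≡ᐞᐞ∧ x y)) (⊓̄-closed x∈F[G] y∈F[G])
      }

  F[G]∩S̄≐G : G ⊆ S̄ L → F[_] L G ∩ S̄ L ≐ G
  F[G]∩S̄≐G {G = G} G⊆S̄ =
      (λ (xᐞᐞ∈G , x∈S̄) → subst G x∈S̄ xᐞᐞ∈G)
    , (λ x∈G → subst G (sym (G⊆S̄ x∈G)) x∈G , G⊆S̄ x∈G)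

  F∩S̄-isS̄Filter : IsSFilter L F → IsS̄Filter L (F ∩ S̄ L)
  F∩S̄-isS̄Filter F-sf = record
    { ⊆S̄       = λ (_ , x∈S̄) → x∈S̄
    ; nonempty =
        let f , f∈F = nonempty in f ᐞ ᐞ , isSFilter⇒ᐞᐞ-closed F-sf f∈F , ᐞᐞ∈S̄ f
    ; upward   = λ (x∈F , _) y∈S̄ x≤y → upward x∈F x≤y , y∈S̄
    ; ⊓̄-closed = λ {x} {y} (x∈F , _) (y∈F , _) → ⊓̄-closed x∈F y∈F , ᐞ∈S̄ (x ᐞ ∨ y ᐞ)
    }
    where
    open IsSFilter F-sf
    open IsFilter isFilter

  F[F∩S̄]≐F : IsSFilter L F → F[_] L (F ∩ S̄ L) ≐ F
  F[F∩S̄]≐F F-sf =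
      (λ (xᐞᐞ∈F , _) → IsFilter.upward (IsSFilter.isFilter F-sf) xᐞᐞ∈F (ΔΔ-≤ _))
    , (λ {x} x∈F → isSFilter⇒ᐞᐞ-closed F-sf x∈F , ᐞᐞ∈S̄ x)

  isPrimary⇔F∩S̄-isPrimary :
    IsSFilter L F → IsPrimaryFilter L F ⇔ IsPrimaryS̄Filter L (F ∩ S̄ L)
  isPrimary⇔F∩S̄-isPrimary {F = F} F-sf = mk⇔ restrict extend
    where
    restrict : IsPrimaryFilter L F → IsPrimaryS̄Filter L (F ∩ S̄ L)
    restrict (_ , primary) =
      F∩S̄-isS̄Filter F-sf , λ x x∈S̄ → Sum.map (_, x∈S̄) (_, ᐞ∈S̄ x) (primary x)

    extend : IsPrimaryS̄Filter L (F ∩ S̄ L) → IsPrimaryFilter L F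
    extend (_ , primary) =
        IsSFilter.isFilter F-sf
      , λ x → Sum.map (proj₁ (F[F∩S̄]≐F F-sf))
                      (λ (xᐞᐞᐞ∈F , _) → subst F (ᐞᐞᐞ≡ᐞ x) xᐞᐞᐞ∈F)
                      (primary (x ᐞ ᐞ) (ᐞᐞ∈S̄ x))

proposition4p5 : {c ℓ₁ ℓ₂ : Level} (L : WDL c)
    (F : Pred (WDL.Carrier L) ℓ₁) (G : Pred (WDL.Carrier L) ℓ₂) →
    IsSFilter L F → IsS̄Filter L G →
    ((IsSFilter L (F[_] L G) × (F[_] L G ∩ S̄ L) ≐ G)
    × (IsS̄Filter L (F ∩ S̄ L) × F[_] L (F ∩ S̄ L) ≐ F)
    × (IsPrimaryFilter L F ⇔ IsPrimaryS̄Filter L (F ∩ S̄ L)))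
proposition4p5 L F G F-sf G-f =
    (F[G]-isSFilter G-f , F[G]∩S̄≐G (IsS̄Filter.⊆S̄ G-f))
  , (F∩S̄-isS̄Filter F-sf , F[F∩S̄]≐F F-sf)
  , isPrimary⇔F∩S̄-isPrimary F-sf
  where open Filters L
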